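{- Let $\mathbb{F}_q$ be a finite field, $r$ a prime divisor of $q-1$, $\rho\in\mathbb{F}_q$ a primitive $r$-th root of unity, and $\beta=\alpha^r$ for some $\alpha\in\mathbb{F}_q^\times$. For $a\in\mathbb{F}_q$ and a positive integer $k$ let $g_{a,k}(x)=(a-x)^k-(a-\rho x)^k\in\mathbb{F}_q[x]$. Then there are at most $k$ distinct $a\in\mathbb{F}_q$ such that $a^r\neq\beta$ and $g_{a,k}(x)\equiv 0\pmod{x^r-\beta}$. -}

module Defs where

open import Level using (Level; _⊔_) renaming (suc to lsuc)
open import Algebra.Bundles using (CommutativeRing; Semiring)
open import Data.Nat using (ℕ; zero; suc; _<_)
open import Data.Fin using (Fin)
open import Data.List using (List; []; _∷_; map; replicate; _++_)
open import Data.Product using (∃)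
open import Relation.Nullary using (¬_)
open import Relation.Binary.PropositionalEquality using (_≡_)

-- The number of elements q is 'size'.
record FiniteField (c ℓ : Level) : Set (lsuc (c ⊔ ℓ)) where
  field
    commutativeRing : CommutativeRing c ℓ
  open CommutativeRing commutativeRing public
  field
    1≉0      : ¬ (1# ≈ 0#)
    inverse  : ∀ x → ¬ (x ≈ 0#) → ∃ λ y → x * y ≈ 1#
    size     : ℕ
    enum     : Fin size → Carrier
    enum-surj : ∀ x → ∃ λ i → enum i ≈ x
    enum-inj  : ∀ i j → enum i ≈ enum j → i ≡ j

  open import Algebra.Definitions.RawSemiring (Semiring.rawSemiring semiring) public using (_^_)

  IsPrimitiveRoot : ℕ → Carrier → Set ℓ
  IsPrimitiveRoot r ρ = (ρ ^ r ≈ 1#) Data.Product.× (∀ j → 0 < j → j < r → ¬ (ρ ^ j ≈ 1#))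

  -- Polynomials over the field: coefficient lists, lowest degree first.
  Poly : Set c
  Poly = List Carrier

  coeff : Poly → ℕ → Carrier
  coeff []       _       = 0#
  coeff (a ∷ p)  zero    = a
  coeff (a ∷ p)  (suc n) = coeff p n

  infixl 6 _+P_ _-P_
  infixl 7 _*P_

  _+P_ : Poly → Poly → Poly
  []      +P q       = q
  (a ∷ p) +P []      = a ∷ p
  (a ∷ p) +P (b ∷ q) = (a + b) ∷ (p +P q)

  negP : Poly → Poly
  negP = map (-_)

  _-P_ : Poly → Poly → Poly
  p -P q = p +P negP q

  scaleP : Carrier → Poly → Poly
  scaleP a = map (a *_)

  _*P_ : Poly → Poly → Poly
  []      *P q = []
  (a ∷ p) *P q = scaleP a q +P (0# ∷ (p *P q))

  _^P_ : Poly → ℕ → Poly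
  p ^P zero  = 1# ∷ []
  p ^P suc n = p *P (p ^P n)

  constP : Carrier → Poly
  constP a = a ∷ []

  linP : Carrier → Poly
  linP b = 0# ∷ b ∷ []

  monoP : ℕ → Poly
  monoP n = replicate n 0# ++ (1# ∷ [])

  -- divisibility in F[x]: d ∣ g iff g = d·h for some polynomial h
  -- (equality of polynomials = equality of all coefficients)
  _∣P_ : Poly → Poly → Set (c ⊔ ℓ)
  d ∣P g = ∃ λ (h : Poly) → ∀ n → coeff g n ≈ coeff (d *P h) n

  _≡0mod_ : Poly → Poly → Set (c ⊔ ℓ)
  g ≡0mod m = m ∣P g

  gPoly : Carrier → Carrier → ℕ → Poly
  gPoly ρ a k = ((constP a -P linP 1#) ^P k) -P ((constP a -P linP ρ) ^P k)

  binomP : ℕ → Carrier → Poly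
  binomP r β = monoP r -P constP β

-- Every admissible a satisfies g_{a,k}(α) = 0, because α is a root of x^r − β
-- and hence of every multiple of it. So each such a is a root of the
-- polynomial D(y) = (y − α)^k − (y − ρα)^k, whose degree is at most k. But
-- D(α) = −(α − ρα)^k ≠ 0, since α ≠ 0 and ρ ≠ 1 (r is prime, so r > 1);
-- a nonzero polynomial of degree at most k over a field has at most k roots.
module Submission where

open import Defs
open import Data.Nat using (ℕ; _≤_; _∸_)
open import Data.Nat.Divisibility using (_∣_)
open import Data.Nat.Primality using (Prime)
open import Data.List using (List; length)
open import Data.List.Relation.Unary.All using (All)
open import Data.List.Relation.Unary.AllPairs using (AllPairs)
open import Data.Product using (_×_)
open import Relation.Nullary using (¬_)

open import Data.Nat using (zero; suc; z≤n; s≤s; s≤s⁻¹; _<_; nonTrivial⇒n>1)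
open import Data.Nat.Properties using (m≤n⇒m≤1+n; <-≤-trans)
open import Data.Nat.Primality using (prime⇒nonTrivial)
open import Data.List using ([]; _∷_)
open import Data.List.Properties using (length-map)
open import Data.List.Relation.Unary.All using ([]; _∷_)
import Data.List.Relation.Unary.All as All
open import Data.List.Relation.Unary.AllPairs using ([]; _∷_)
open import Data.Product using (_,_; proj₂)
open import Data.Empty using (⊥-elim)
open import Function using (_∘_)
open import Relation.Binary.PropositionalEquality as ≡ using (_≡_)

module FieldPolynomials {c ℓ} (F : FiniteField c ℓ) where
  open FiniteField F
  open import Algebra.Solver.Ring.NaturalCoefficients.Default commutativeSemiring
  open import Relation.Binary.Reasoning.Setoid setoid
  open import Algebra.Properties.Group +-group using (x∙y⁻¹≈ε⇒x≈y; x≈y⇒x∙y⁻¹≈ε; inverseʳ-unique; ε⁻¹≈ε)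
  open import Algebra.Properties.Ring ring using (-‿distribʳ-*)
  open import Algebra.Properties.Semiring.Exp semiring using (^-congˡ)

  x≉y⇒x-y≉0 : ∀ {x y} → x ≉ y → x - y ≉ 0#
  x≉y⇒x-y≉0 {x} {y} x≉y x-y≈0 = x≉y (x∙y⁻¹≈ε⇒x≈y x y x-y≈0)

  x≉0⇒x*y≈0⇒y≈0 : ∀ {x y} → x ≉ 0# → x * y ≈ 0# → y ≈ 0#
  x≉0⇒x*y≈0⇒y≈0 {x} {y} x≉0 xy≈0 with inverse x x≉0
  ... | x⁻¹ , xx⁻¹≈1 = begin
    y              ≈⟨ sym (*-identityˡ y) ⟩
    1# * y         ≈⟨ *-congʳ (sym xx⁻¹≈1) ⟩
    (x * x⁻¹) * y  ≈⟨ solve 3 (λ x x⁻¹ y → (x :* x⁻¹) :* y := x⁻¹ :* (x :* y)) refl x x⁻¹ y ⟩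
    x⁻¹ * (x * y)  ≈⟨ *-congˡ xy≈0 ⟩
    x⁻¹ * 0#       ≈⟨ zeroʳ x⁻¹ ⟩
    0#             ∎

  *-≉0 : ∀ {x y} → x ≉ 0# → y ≉ 0# → x * y ≉ 0#
  *-≉0 x≉0 y≉0 xy≈0 = y≉0 (x≉0⇒x*y≈0⇒y≈0 x≉0 xy≈0)

  ^-≉0 : ∀ {x} → x ≉ 0# → ∀ n → x ^ n ≉ 0#
  ^-≉0 x≉0 zero    = 1≉0
  ^-≉0 x≉0 (suc n) = *-≉0 x≉0 (^-≉0 x≉0 n)

  eval : Poly → Carrier → Carrier
  eval []      x = 0#
  eval (a ∷ p) x = a + x * eval p x

  Root : Poly → Carrier → Set ℓ
  Root p x = eval p x ≈ 0#

  eval-resp-coeff : ∀ p q → (∀ n → coeff p n ≈ coeff q n) → ∀ x → eval p x ≈ eval q x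
  eval-resp-coeff []      []      _      x = refl
  eval-resp-coeff []      (b ∷ q) p≈q    x = begin
    0#                 ≈⟨ solve 1 (λ x → con 0 := con 0 :+ x :* con 0) refl x ⟩
    0# + x * 0#        ≈⟨ +-cong (p≈q 0) (*-congˡ (eval-resp-coeff [] q (λ n → p≈q (suc n)) x)) ⟩
    b + x * eval q x   ∎
  eval-resp-coeff (a ∷ p) []      p≈q    x = begin
    a + x * eval p x   ≈⟨ +-cong (p≈q 0) (*-congˡ (eval-resp-coeff p [] (λ n → p≈q (suc n)) x)) ⟩
    0# + x * 0#        ≈⟨ solve 1 (λ x → con 0 :+ x :* con 0 := con 0) refl x ⟩
    0#                 ∎
  eval-resp-coeff (a ∷ p) (b ∷ q) p≈q    x =
    +-cong (p≈q 0) (*-congˡ (eval-resp-coeff p q (λ n → p≈q (suc n)) x))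

  eval-+P : ∀ p q x → eval (p +P q) x ≈ eval p x + eval q x
  eval-+P []      q       x = sym (+-identityˡ _)
  eval-+P (a ∷ p) []      x = sym (+-identityʳ _)
  eval-+P (a ∷ p) (b ∷ q) x = begin
    (a + b) + x * eval (p +P q) x          ≈⟨ +-congˡ (*-congˡ (eval-+P p q x)) ⟩
    (a + b) + x * (eval p x + eval q x)
      ≈⟨ solve 5 (λ a b x u v → (a :+ b) :+ x :* (u :+ v) := (a :+ x :* u) :+ (b :+ x :* v))
               refl a b x (eval p x) (eval q x) ⟩
    (a + x * eval p x) + (b + x * eval q x) ∎

  eval-negP : ∀ p x → eval (negP p) x ≈ - eval p x
  eval-negP []      x = sym ε⁻¹≈ε
  eval-negP (a ∷ p) x = inverseʳ-unique (eval (a ∷ p) x) (eval (negP (a ∷ p)) x) (begin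
    (a + x * eval p x) + (- a + x * eval (negP p) x)  ≈⟨ +-congˡ (+-congˡ (*-congˡ (eval-negP p x))) ⟩
    (a + x * eval p x) + (- a + x * (- eval p x))
      ≈⟨ solve 5 (λ a a′ x u u′ → (a :+ x :* u) :+ (a′ :+ x :* u′) := (a :+ a′) :+ x :* (u :+ u′))
               refl a (- a) x (eval p x) (- eval p x) ⟩
    (a - a) + x * (eval p x - eval p x)              ≈⟨ +-cong (-‿inverseʳ a) (*-congˡ (-‿inverseʳ _)) ⟩
    0# + x * 0#                                      ≈⟨ solve 1 (λ x → con 0 :+ x :* con 0 := con 0) refl x ⟩
    0#                                               ∎)

  eval--P : ∀ p q x → eval (p -P q) x ≈ eval p x - eval q x
  eval--P p q x = trans (eval-+P p (negP q) x) (+-congˡ (eval-negP q x))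

  eval-scaleP : ∀ s p x → eval (scaleP s p) x ≈ s * eval p x
  eval-scaleP s []      x = sym (zeroʳ s)
  eval-scaleP s (a ∷ p) x = begin
    s * a + x * eval (scaleP s p) x  ≈⟨ +-congˡ (*-congˡ (eval-scaleP s p x)) ⟩
    s * a + x * (s * eval p x)
      ≈⟨ solve 4 (λ s a x u → s :* a :+ x :* (s :* u) := s :* (a :+ x :* u)) refl s a x (eval p x) ⟩
    s * (a + x * eval p x)           ∎

  eval-*P : ∀ p q x → eval (p *P q) x ≈ eval p x * eval q x
  eval-*P []      q x = sym (zeroˡ _)
  eval-*P (a ∷ p) q x = begin
    eval (scaleP a q +P (0# ∷ (p *P q))) x              ≈⟨ eval-+P (scaleP a q) _ x ⟩
    eval (scaleP a q) x + (0# + x * eval (p *P q) x)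
      ≈⟨ +-cong (eval-scaleP a q x) (+-congˡ (*-congˡ (eval-*P p q x))) ⟩
    a * eval q x + (0# + x * (eval p x * eval q x))
      ≈⟨ solve 4 (λ a x u v → a :* v :+ (con 0 :+ x :* (u :* v)) := (a :+ x :* u) :* v)
               refl a x (eval p x) (eval q x) ⟩
    (a + x * eval p x) * eval q x                       ∎

  eval-constP : ∀ a x → eval (constP a) x ≈ a
  eval-constP = solve 2 (λ a x → a :+ x :* con 0 := a) refl

  eval-linP : ∀ b x → eval (linP b) x ≈ b * x
  eval-linP = solve 2 (λ b x → con 0 :+ x :* (b :+ x :* con 0) := b :* x) refl

  eval-^P : ∀ p n x → eval (p ^P n) x ≈ eval p x ^ n
  eval-^P p zero    x = eval-constP 1# x
  eval-^P p (suc n) x = trans (eval-*P p (p ^P n) x) (*-congˡ (eval-^P p n x))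

  eval-monoP : ∀ n x → eval (monoP n) x ≈ x ^ n
  eval-monoP zero    x = eval-constP 1# x
  eval-monoP (suc n) x = trans (+-identityˡ _) (*-congˡ (eval-monoP n x))

  ∣P-Root : ∀ {m g x} → m ∣P g → Root m x → Root g x
  ∣P-Root {m} {g} {x} (h , g≈mh) mx≈0 = begin
    eval g x             ≈⟨ eval-resp-coeff g (m *P h) g≈mh x ⟩
    eval (m *P h) x      ≈⟨ eval-*P m h x ⟩
    eval m x * eval h x  ≈⟨ *-congʳ mx≈0 ⟩
    0# * eval h x        ≈⟨ zeroˡ _ ⟩
    0#                   ∎

  length-+P : ∀ {n} p q → length p ≤ n → length q ≤ n → length (p +P q) ≤ n
  length-+P []      q       _         q≤n       = q≤n
  length-+P (a ∷ p) []      p≤n       _         = p≤n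
  length-+P (a ∷ p) (b ∷ q) (s≤s p≤n) (s≤s q≤n) = s≤s (length-+P p q p≤n q≤n)

  length-*P-linear : ∀ {n} a b q → length q ≤ suc n → length ((a ∷ b ∷ []) *P q) ≤ suc (suc n)
  length-*P-linear {n} a b q q≤1+n =
    length-+P (scaleP a q) _
      (≡.subst (_≤ suc (suc n)) (≡.sym (length-map (a *_) q)) (m≤n⇒m≤1+n q≤1+n))
      (s≤s (length-+P (scaleP b q) (0# ∷ [])
              (≡.subst (_≤ suc n) (≡.sym (length-map (b *_) q)) q≤1+n) (s≤s z≤n)))

  length-^P-linear : ∀ a b k → length ((a ∷ b ∷ []) ^P k) ≤ suc k
  length-^P-linear a b zero    = s≤s z≤n
  length-^P-linear a b (suc k) = length-*P-linear a b (_ ^P k) (length-^P-linear a b k)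

  quotient : Carrier → Poly → Poly
  quotient x₀ []          = []
  quotient x₀ (_ ∷ [])    = []
  quotient x₀ (_ ∷ d ∷ p) = eval (d ∷ p) x₀ ∷ quotient x₀ (d ∷ p)

  length-quotient : ∀ x₀ c p → length (quotient x₀ (c ∷ p)) ≡ length p
  length-quotient x₀ c []      = ≡.refl
  length-quotient x₀ c (d ∷ p) = ≡.cong suc (length-quotient x₀ d p)

  eval-quotient : ∀ x₀ p y → eval p y ≈ (y - x₀) * eval (quotient x₀ p) y + eval p x₀
  eval-quotient x₀ [] y =
    solve 1 (λ z → con 0 := z :* con 0 :+ con 0) refl (y - x₀)
  eval-quotient x₀ (c ∷ []) y =
    solve 4 (λ c y z x₀ → c :+ y :* con 0 := z :* con 0 :+ (c :+ x₀ :* con 0)) refl c y (y - x₀) x₀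
  eval-quotient x₀ (c ∷ d ∷ p) y = begin
    c + y * eval (d ∷ p) y                ≈⟨ +-congˡ (*-congˡ (eval-quotient x₀ (d ∷ p) y)) ⟩
    c + y * (z * q + e)                   ≈⟨ +-congˡ (*-congʳ y≈z+x₀) ⟩
    c + (z + x₀) * (z * q + e)
      ≈⟨ solve 5 (λ c z x₀ q e → c :+ (z :+ x₀) :* (z :* q :+ e) := z :* (e :+ (z :+ x₀) :* q) :+ (c :+ x₀ :* e))
               refl c z x₀ q e ⟩
    z * (e + (z + x₀) * q) + (c + x₀ * e) ≈⟨ +-congʳ (*-congˡ (+-congˡ (*-congʳ (sym y≈z+x₀)))) ⟩
    z * (e + y * q) + (c + x₀ * e)        ∎
    where
    z = y - x₀
    q = eval (quotient x₀ (d ∷ p)) y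
    e = eval (d ∷ p) x₀
    -- the semiring solver cannot see through subtraction, so y is rewritten as z + x₀
    y≈z+x₀ : y ≈ z + x₀
    y≈z+x₀ = begin
      y              ≈⟨ sym (+-identityʳ y) ⟩
      y + 0#         ≈⟨ +-congˡ (sym (-‿inverseˡ x₀)) ⟩
      y + (- x₀ + x₀) ≈⟨ sym (+-assoc y (- x₀) x₀) ⟩
      z + x₀         ∎

  Root⇒Root-quotient : ∀ {x₀ z} p → Root p x₀ → x₀ ≉ z → Root p z → Root (quotient x₀ p) z
  Root⇒Root-quotient {x₀} {z} p px₀≈0 x₀≉z pz≈0 = x≉0⇒x*y≈0⇒y≈0 (x≉y⇒x-y≉0 (x₀≉z ∘ sym)) (begin
    (z - x₀) * eval (quotient x₀ p) z             ≈⟨ sym (+-identityʳ _) ⟩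
    (z - x₀) * eval (quotient x₀ p) z + 0#        ≈⟨ +-congˡ (sym px₀≈0) ⟩
    (z - x₀) * eval (quotient x₀ p) z + eval p x₀ ≈⟨ sym (eval-quotient x₀ p z) ⟩
    eval p z                                      ≈⟨ pz≈0 ⟩
    0#                                            ∎)

  Root⇒quotient-≉0 : ∀ {x₀ y} p → Root p x₀ → eval p y ≉ 0# → eval (quotient x₀ p) y ≉ 0#
  Root⇒quotient-≉0 {x₀} {y} p px₀≈0 py≉0 qy≈0 = py≉0 (begin
    eval p y                                      ≈⟨ eval-quotient x₀ p y ⟩
    (y - x₀) * eval (quotient x₀ p) y + eval p x₀ ≈⟨ +-cong (*-congˡ qy≈0) px₀≈0 ⟩
    (y - x₀) * 0# + 0#                            ≈⟨ solve 1 (λ z → z :* con 0 :+ con 0 := con 0) refl (y - x₀) ⟩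
    0#                                            ∎)

  distinctRoots<length : ∀ {xs y} p → AllPairs _≉_ xs → All (Root p) xs → eval p y ≉ 0# →
                         length xs < length p
  distinctRoots<length                []      _                  _                 py≉0 = ⊥-elim (py≉0 refl)
  distinctRoots<length {[]}           (c ∷ p) _                  _                 _    = s≤s z≤n
  distinctRoots<length {x₀ ∷ xs} {y}  (c ∷ p) (x₀≉xs ∷ distinct) (px₀≈0 ∷ roots) py≉0 =
    s≤s (≡.subst (length xs <_) (length-quotient x₀ c p)
      (distinctRoots<length (quotient x₀ (c ∷ p)) distinct
        (All.zipWith (λ (x₀≉x , px≈0) → Root⇒Root-quotient (c ∷ p) px₀≈0 x₀≉x px≈0) (x₀≉xs , roots))
        (Root⇒quotient-≉0 (c ∷ p) px₀≈0 py≉0)))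

  X-_ : Carrier → Poly
  X- u = - u ∷ 1# ∷ []

  eval-X- : ∀ u y → eval (X- u) y ≈ y - u
  eval-X- u y = solve 2 (λ u′ y → u′ :+ y :* (con 1 :+ y :* con 0) := y :+ u′) refl (- u) y

  powerDifference : Carrier → Carrier → ℕ → Poly
  powerDifference u v k = (X- u) ^P k -P (X- v) ^P k

  eval-powerDifference : ∀ u v k y → eval (powerDifference u v k) y ≈ (y - u) ^ k - (y - v) ^ k
  eval-powerDifference u v k y = trans (eval--P ((X- u) ^P k) ((X- v) ^P k) y)
    (+-cong (trans (eval-^P (X- u) k y) (^-congˡ k (eval-X- u y)))
            (-‿cong (trans (eval-^P (X- v) k y) (^-congˡ k (eval-X- v y)))))

  length-powerDifference : ∀ u v k → length (powerDifference u v k) ≤ suc k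
  length-powerDifference u v k =
    length-+P ((X- u) ^P k) (negP ((X- v) ^P k)) (length-^P-linear (- u) 1# k)
      (≡.subst (_≤ suc k) (≡.sym (length-map (-_) ((X- v) ^P k))) (length-^P-linear (- v) 1# k))

  powerDifference-≉0 : ∀ {u v} k → 1 ≤ k → u ≉ v → eval (powerDifference u v k) u ≉ 0#
  powerDifference-≉0 {u} {v} k@(suc _) (s≤s z≤n) u≉v pu≈0 =
    ^-≉0 (x≉y⇒x-y≉0 u≉v) k (sym (x∙y⁻¹≈ε⇒x≈y 0# ((u - v) ^ k) (begin
      0# - (u - v) ^ k              ≈⟨ +-congʳ (sym (trans (*-congʳ (-‿inverseʳ u)) (zeroˡ _))) ⟩
      (u - u) ^ k - (u - v) ^ k     ≈⟨ sym (eval-powerDifference u v k u) ⟩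
      eval (powerDifference u v k) u ≈⟨ pu≈0 ⟩
      0#                            ∎)))

  eval-constP-linP : ∀ a b x → eval (constP a -P linP b) x ≈ a - b * x
  eval-constP-linP a b x =
    trans (eval--P (constP a) (linP b) x) (+-cong (eval-constP a x) (-‿cong (eval-linP b x)))

  eval-gPoly : ∀ ρ a k x → eval (gPoly ρ a k) x ≈ (a - x) ^ k - (a - ρ * x) ^ k
  eval-gPoly ρ a k x = begin
    eval (gPoly ρ a k) x                    ≈⟨ eval--P (L 1# ^P k) (L ρ ^P k) x ⟩
    eval (L 1# ^P k) x - eval (L ρ ^P k) x  ≈⟨ +-cong (eval-L^k 1#) (-‿cong (eval-L^k ρ)) ⟩
    (a - 1# * x) ^ k - (a - ρ * x) ^ k      ≈⟨ +-congʳ (^-congˡ k (+-congˡ (-‿cong (*-identityˡ x)))) ⟩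
    (a - x) ^ k - (a - ρ * x) ^ k           ∎
    where
    L : Carrier → Poly
    L b = constP a -P linP b
    eval-L^k : ∀ b → eval (L b ^P k) x ≈ (a - b * x) ^ k
    eval-L^k b = trans (eval-^P (L b) k x) (^-congˡ k (eval-constP-linP a b x))

  gPoly-Root⇒powerDifference-Root : ∀ {ρ a x} k → Root (gPoly ρ a k) x →
                                    Root (powerDifference x (ρ * x) k) a
  gPoly-Root⇒powerDifference-Root {ρ} {a} {x} k gx≈0 = begin
    eval (powerDifference x (ρ * x) k) a  ≈⟨ eval-powerDifference x (ρ * x) k a ⟩
    (a - x) ^ k - (a - ρ * x) ^ k         ≈⟨ sym (eval-gPoly ρ a k x) ⟩
    eval (gPoly ρ a k) x                  ≈⟨ gx≈0 ⟩
    0#                                    ∎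

  binomP-Root : ∀ r {α β} → β ≈ α ^ r → Root (binomP r β) α
  binomP-Root r {α} {β} β≈α^r = begin
    eval (binomP r β) α                    ≈⟨ eval--P (monoP r) (constP β) α ⟩
    eval (monoP r) α - eval (constP β) α   ≈⟨ +-cong (eval-monoP r α) (-‿cong (trans (eval-constP β α) β≈α^r)) ⟩
    α ^ r - α ^ r                          ≈⟨ -‿inverseʳ _ ⟩
    0#                                     ∎

  x≉0⇒x≉y*x : ∀ {x y} → x ≉ 0# → y ≉ 1# → x ≉ y * x
  x≉0⇒x≉y*x {x} {y} x≉0 y≉1 x≈yx = y≉1 (sym (x∙y⁻¹≈ε⇒x≈y 1# y
    (x≉0⇒x*y≈0⇒y≈0 x≉0 (begin
      x * (1# - y)     ≈⟨ distribˡ x 1# (- y) ⟩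
      x * 1# + x * - y ≈⟨ +-cong (*-identityʳ x) (sym (-‿distribʳ-* x y)) ⟩
      x - x * y        ≈⟨ +-congˡ (-‿cong (*-comm x y)) ⟩
      x - y * x        ≈⟨ x≈y⇒x∙y⁻¹≈ε x≈yx ⟩
      0#               ∎))))

  primitiveRoot≉1 : ∀ {r ρ} → 1 < r → IsPrimitiveRoot r ρ → ρ ≉ 1#
  primitiveRoot≉1 {ρ = ρ} 1<r (_ , ρ^j≉1) ρ≈1 = ρ^j≉1 1 (s≤s z≤n) 1<r (trans (*-identityʳ ρ) ρ≈1)

lemma3p3 : ∀ {c ℓ} (F : FiniteField c ℓ) → let open FiniteField F in
    (r : ℕ) → Prime r → r ∣ (size ∸ 1) →
    (ρ : Carrier) → IsPrimitiveRoot r ρ →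
    (α β : Carrier) → ¬ (α ≈ 0#) → β ≈ α ^ r →
    (k : ℕ) → 1 ≤ k →
    (as : List Carrier) → AllPairs (λ x y → ¬ (x ≈ y)) as →
    All (λ a → (¬ (a ^ r ≈ β)) × (gPoly ρ a k ≡0mod binomP r β)) as →
    length as ≤ k
lemma3p3 F r r-prime _ ρ ρ-primitive α β α≉0 β≈α^r k 1≤k as distinct admissible =
  s≤s⁻¹ (<-≤-trans as<D (length-powerDifference α (ρ * α) k))
  where
  open FiniteField F
  open FieldPolynomials F
  D : Poly
  D = powerDifference α (ρ * α) k
  admissible⇒Root : ∀ {a} → gPoly ρ a k ≡0mod binomP r β → Root D a
  admissible⇒Root {a} g≡0 = gPoly-Root⇒powerDifference-Root k
    (∣P-Root {binomP r β} {gPoly ρ a k} g≡0 (binomP-Root r β≈α^r))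
  ρ≉1 : ρ ≉ 1#
  ρ≉1 = primitiveRoot≉1 (nonTrivial⇒n>1 r {{prime⇒nonTrivial r-prime}}) ρ-primitive
  D[α]≉0 : eval D α ≉ 0#
  D[α]≉0 = powerDifference-≉0 k 1≤k (x≉0⇒x≉y*x α≉0 ρ≉1)
  as<D : length as < length D
  as<D = distinctRoots<length D distinct (All.map (admissible⇒Root ∘ proj₂) admissible) D[α]≉0
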